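{- Let $w\ge3$ and let $A_w$ be the set of integers $0<n\le 10^w-1$ whose $w$-digit decimal representation (leading zeros allowed) does not have all digits equal. Define $T:A_w\to\mathbb{Z}$ as follows: let $X=(a_0\,b_0\cdots z_0)$ be the $w$-digit number obtained by arranging the digits of $n$ in descending order, let $Y$ be the number obtained from $X$ by interchanging its first and last digits, i.e. $Y=(z_0\,b_0\cdots a_0)$, and set $T(n)=X-Y$. Then $T$ maps $A_w$ into $A_w$; the number $4\,\underbrace{9\cdots9}_{w-2}\,5$ is the unique fixed point of $T$ in $A_w$; and for every $n\in A_w$ some iterate $T^k(n)$, $k\ge0$, equals $4\,\underbrace{9\cdots9}_{w-2}\,5$.
   Context: Numbers are written in base 10 with exactly $w$ digits, padding with leading zeros. -}

module Defs where

open import Data.Nat using (ℕ; zero; suc; _+_; _*_; _∸_; _^_; _≤_; _<_)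
open import Data.Nat.DivMod using (_/_; _%_)
open import Data.Nat.Properties using (≤-decTotalOrder)
open import Data.Integer using (ℤ; +_; _-_)
open import Data.List using (List; []; _∷_; _++_; [_]; reverse; replicate; foldl)
open import Data.List.Relation.Unary.All using (All)
open import Data.Product using (Σ; _×_)
open import Relation.Binary.PropositionalEquality using (_≡_)
open import Relation.Nullary using (¬_)
open import Relation.Binary.Properties.DecTotalOrder ≤-decTotalOrder using (≥-decTotalOrder)
open import Data.List.Sort ≥-decTotalOrder using (sort)

digits : ℕ → ℕ → List ℕ
digits zero    n = []
digits (suc w) n = digits w (n / 10) ++ [ n % 10 ]

fromDigits : List ℕ → ℕ
fromDigits = foldl (λ acc d → 10 * acc + d) 0

AllDigitsEqual : ℕ → ℕ → Set
AllDigitsEqual w n = Σ ℕ (λ d → All (_≡ d) (digits w n))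

A : ℕ → ℕ → Set
A w n = (0 < n) × (n ≤ 10 ^ w ∸ 1) × ¬ AllDigitsEqual w n

swapEnds : List ℕ → List ℕ
swapEnds []          = []
swapEnds (a ∷ [])    = a ∷ []
swapEnds (a ∷ b ∷ t) with reverse (b ∷ t)
... | []     = a ∷ b ∷ t
... | z ∷ rm = z ∷ (reverse rm ++ [ a ])

Xdigits : ℕ → ℕ → List ℕ
Xdigits w n = sort (digits w n)

X : ℕ → ℕ → ℕ
X w n = fromDigits (Xdigits w n)

Y : ℕ → ℕ → ℕ
Y w n = fromDigits (swapEnds (Xdigits w n))

T : ℕ → ℕ → ℤ
T w n = + X w n - + Y w n

K : ℕ → ℕ
K w = fromDigits (4 ∷ replicate (w ∸ 2) 9 ++ [ 5 ])

iter : (ℕ → ℕ) → ℕ → ℕ → ℕ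
iter f zero    n = n
iter f (suc k) n = f (iter f k n)

{-# OPTIONS --safe #-}
-- Sorting puts the largest digit x first and the smallest z last, and interchanging
-- them lowers the number by (x − z)·9…9 (w − 1 nines).  Hence T(n) = a·9…9 where
-- the spread a = x − z lies in 1..9 exactly when n ∈ A_w.  For such a the digits of
-- a·9…9 are a − 1, 9, …, 9, 10 − a; since w ≥ 3 there is an interior 9, so
-- T(a·9…9) = a′·9…9 with a′ = 9 − min (a − 1) (10 − a).  On 1..9 the map a ↦ a′
-- has the single fixed point 5 and reaches it within six steps, and 5·9…9 = 49…95.
module Submission where

open import Defs
open import Data.Nat
open import Data.Nat.Properties
open import Data.Nat.DivMod
open import Data.Nat.Divisibility using (divides-refl)
open import Data.Nat.Tactic.RingSolver using (solve-∀)
open import Data.Integer as ℤ using (+_; ∣_∣)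
import Data.Integer.Properties as ℤ
open import Data.List using (List; []; _∷_; _++_; [_]; _∷ʳ_; replicate; reverse; foldl; length)
open import Data.List.Properties using (length-++; length-replicate; foldl-∷ʳ; reverse-++; reverse-involutive)
open import Data.List.Reverse using (Reverse; []; _∶_∶ʳ_; reverseView)
open import Data.List.Membership.Propositional using (_∈_)
open import Data.List.Membership.Propositional.Properties using (∈-++⁺ʳ)
open import Data.List.Relation.Unary.Any using (here; there)
open import Data.List.Relation.Unary.All as All using (All; []; _∷_)
open import Data.List.Relation.Unary.All.Properties using (++⁺; ++⁻ˡ; ++⁻ʳ; replicate⁺)
open import Data.List.Relation.Unary.Linked using (Linked; _∷_)
open import Data.List.Relation.Unary.Linked.Properties using (Linked⇒All)
open import Data.List.Relation.Binary.Permutation.Propositional.Properties using (All-resp-↭; ∈-resp-↭; ↭-length)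
open import Relation.Binary.Properties.DecTotalOrder ≤-decTotalOrder using (≥-decTotalOrder)
open import Data.List.Sort ≥-decTotalOrder using (sort; sort-↭; sort-↗)
open import Data.Product using (Σ; ∃; ∃₂; _×_; _,_; proj₁; proj₂)
open import Data.Sum using (inj₁; inj₂)
open import Function using (flip)
open import Relation.Nullary using (¬_)
open import Relation.Nullary.Decidable using (toWitness; _→-dec_)
open import Relation.Binary.PropositionalEquality using (_≡_; refl; sym; trans; cong; cong₂; subst; subst₂; module ≡-Reasoning)

length-∷ʳ : ∀ {X : Set} (xs : List X) (x : X) → length (xs ∷ʳ x) ≡ suc (length xs)
length-∷ʳ xs x = trans (length-++ xs) (+-comm (length xs) 1)

replicate-∷ʳ : ∀ {X : Set} m (x : X) → replicate (suc m) x ≡ replicate m x ∷ʳ x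
replicate-∷ʳ zero    x = refl
replicate-∷ʳ (suc m) x = cong (x ∷_) (replicate-∷ʳ m x)

fromDigits-∷ʳ : ∀ ds d → fromDigits (ds ∷ʳ d) ≡ 10 * fromDigits ds + d
fromDigits-∷ʳ ds d = foldl-∷ʳ _ 0 d ds

fromDigits-∷ : ∀ d ds → fromDigits (d ∷ ds) ≡ d * 10 ^ length ds + fromDigits ds
fromDigits-∷ d ds = foldl-from d ds
  where
  foldl-from : ∀ acc ds → foldl (λ acc d → 10 * acc + d) acc ds ≡ acc * 10 ^ length ds + fromDigits ds
  foldl-from acc []       = sym (trans (+-identityʳ _) (*-identityʳ acc))
  foldl-from acc (d ∷ ds) = begin
    foldl _ (10 * acc + d) ds                         ≡⟨ foldl-from (10 * acc + d) ds ⟩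
    (10 * acc + d) * P + fromDigits ds                ≡⟨ regroup acc d P (fromDigits ds) ⟩
    acc * (10 * P) + (d * P + fromDigits ds)          ≡⟨ cong (_+_ (acc * (10 * P))) (foldl-from d ds) ⟨
    acc * (10 * P) + foldl _ d ds                     ∎
    where
    open ≡-Reasoning
    P : ℕ
    P = 10 ^ length ds
    regroup : ∀ a d P F → (10 * a + d) * P + F ≡ a * (10 * P) + (d * P + F)
    regroup = solve-∀

fromDigits-ends : ∀ x mid z → fromDigits (x ∷ mid ++ [ z ]) ≡ x * 10 ^ suc (length mid) + (10 * fromDigits mid + z)
fromDigits-ends x mid z = begin
  fromDigits (x ∷ mid ++ [ z ])                              ≡⟨ fromDigits-∷ x (mid ++ [ z ]) ⟩
  x * 10 ^ length (mid ++ [ z ]) + fromDigits (mid ++ [ z ]) ≡⟨ cong₂ (λ L F → x * 10 ^ L + F) (length-∷ʳ mid z) (fromDigits-∷ʳ mid z) ⟩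
  x * 10 ^ suc (length mid) + (10 * fromDigits mid + z)      ∎
  where open ≡-Reasoning

fromDigits-< : ∀ {ds} → All (_< 10) ds → fromDigits ds < 10 ^ length ds
fromDigits-< {[]}     []             = s≤s z≤n
fromDigits-< {d ∷ ds} (d<10 ∷ ds<10) = begin-strict
  fromDigits (d ∷ ds)     ≡⟨ fromDigits-∷ d ds ⟩
  d * P + fromDigits ds   <⟨ +-monoʳ-< (d * P) (fromDigits-< ds<10) ⟩
  d * P + P               ≡⟨ +-comm (d * P) P ⟩
  suc d * P               ≤⟨ *-monoˡ-≤ P d<10 ⟩
  10 * P                  ∎
  where
  open ≤-Reasoning
  P : ℕ
  P = 10 ^ length ds

nines : ℕ → ℕ
nines m = fromDigits (replicate m 9)

nines-suc : ∀ m → nines (suc m) ≡ 10 * nines m + 9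
nines-suc m = trans (cong fromDigits (replicate-∷ʳ m 9)) (fromDigits-∷ʳ (replicate m 9) 9)

suc-nines : ∀ m → suc (nines m) ≡ 10 ^ m
suc-nines zero    = refl
suc-nines (suc m) = begin
  suc (nines (suc m))     ≡⟨ cong suc (nines-suc m) ⟩
  suc (10 * nines m + 9)  ≡⟨ shift (nines m) ⟩
  10 * suc (nines m)      ≡⟨ cong (10 *_) (suc-nines m) ⟩
  10 ^ suc m              ∎
  where
  open ≡-Reasoning
  shift : ∀ N → suc (10 * N + 9) ≡ 10 * suc N
  shift = solve-∀

nines-suc-pos : ∀ m → 0 < nines (suc m)
nines-suc-pos m = subst (0 <_) (sym (nines-suc m)) (≤-trans (s≤s z≤n) (m≤n+m 9 (10 * nines m)))

[10m+d]/10≡m : ∀ m {d} → d < 10 → (10 * m + d) / 10 ≡ m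
[10m+d]/10≡m m {d} d<10 = begin
  (10 * m + d) / 10      ≡⟨ /-congˡ (trans (+-comm (10 * m) d) (cong (_+_ d) (*-comm 10 m))) ⟩
  (d + m * 10) / 10      ≡⟨ +-distrib-/-∣ʳ d (divides-refl m) ⟩
  d / 10 + m * 10 / 10   ≡⟨ cong₂ _+_ (m<n⇒m/n≡0 d<10) (m*n/n≡m m 10) ⟩
  m                      ∎
  where open ≡-Reasoning

[10m+d]%10≡d : ∀ m {d} → d < 10 → (10 * m + d) % 10 ≡ d
[10m+d]%10≡d m {d} d<10 = begin
  (10 * m + d) % 10   ≡⟨ %-congˡ (trans (+-comm (10 * m) d) (cong (_+_ d) (*-comm 10 m))) ⟩
  (d + m * 10) % 10   ≡⟨ [m+kn]%n≡m%n d m 10 ⟩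
  d % 10              ≡⟨ m<n⇒m%n≡m d<10 ⟩
  d                   ∎
  where open ≡-Reasoning

length-digits : ∀ w n → length (digits w n) ≡ w
length-digits zero    n = refl
length-digits (suc w) n = trans (length-∷ʳ (digits w (n / 10)) (n % 10)) (cong suc (length-digits w (n / 10)))

digits-< : ∀ w n → All (_< 10) (digits w n)
digits-< zero    n = []
digits-< (suc w) n = ++⁺ (digits-< w (n / 10)) (m%n<n n 10 ∷ [])

digits-fromDigits : ∀ {w} ds → length ds ≡ w → All (_< 10) ds → digits w (fromDigits ds) ≡ ds
digits-fromDigits ds refl = go (reverseView ds)
  where
  go : ∀ {ds} → Reverse ds → All (_< 10) ds → digits (length ds) (fromDigits ds) ≡ ds
  go []             _    = refl
  go (ds ∶ r ∶ʳ d) ds<10 = begin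
    digits (length (ds ∷ʳ d)) (fromDigits (ds ∷ʳ d))                 ≡⟨ cong₂ digits (length-∷ʳ ds d) (fromDigits-∷ʳ ds d) ⟩
    digits (length ds) ((10 * F + d) / 10) ++ [ (10 * F + d) % 10 ]  ≡⟨ cong₂ (λ m e → digits (length ds) m ++ [ e ]) ([10m+d]/10≡m F d<10) ([10m+d]%10≡d F d<10) ⟩
    digits (length ds) F ++ [ d ]                                    ≡⟨ cong (_∷ʳ d) (go r (++⁻ˡ ds ds<10)) ⟩
    ds ∷ʳ d                                                          ∎
    where
    open ≡-Reasoning
    F : ℕ
    F = fromDigits ds
    d<10 : d < 10
    d<10 = All.head (++⁻ʳ ds ds<10)

swapEnds-ends : ∀ x mid z → swapEnds (x ∷ mid ++ [ z ]) ≡ z ∷ mid ++ [ x ]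
swapEnds-ends x []      z = refl
swapEnds-ends x (y ∷ mid) z with reverse (y ∷ mid ++ [ z ]) | reverse-++ (y ∷ mid) [ z ]
... | .(z ∷ reverse (y ∷ mid)) | refl = cong (λ t → z ∷ t ++ [ x ]) (reverse-involutive (y ∷ mid))

m≡n+o⇒+m-+n≡+o : ∀ {m} n {o} → m ≡ n + o → + m ℤ.- + n ≡ + o
m≡n+o⇒+m-+n≡+o n {o} refl = begin
  + (n + o) ℤ.- + n  ≡⟨ ℤ.[+m]-[+n]≡m⊖n (n + o) n ⟩
  (n + o) ℤ.⊖ n      ≡⟨ ℤ.⊖-≥ (m≤m+n n o) ⟩
  + (n + o ∸ n)      ≡⟨ cong +_ (m+n∸m≡n n o) ⟩
  + o                ∎
  where open ≡-Reasoning

fromDigits-swapEnds : ∀ {x z} mid → z ≤ x →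
  fromDigits (x ∷ mid ++ [ z ]) ≡ fromDigits (swapEnds (x ∷ mid ++ [ z ])) + (x ∸ z) * nines (suc (length mid))
fromDigits-swapEnds {x} {z} mid z≤x = begin
  fromDigits (x ∷ mid ++ [ z ])                    ≡⟨ fromDigits-ends x mid z ⟩
  x * 10 ^ suc L + (10 * M + z)                    ≡⟨ cong (λ P → x * P + (10 * M + z)) (suc-nines (suc L)) ⟨
  x * suc N + (10 * M + z)                         ≡⟨ exchange z≤x ⟩
  z * suc N + (10 * M + x) + (x ∸ z) * N           ≡⟨ cong (λ P → z * P + (10 * M + x) + (x ∸ z) * N) (suc-nines (suc L)) ⟩
  z * 10 ^ suc L + (10 * M + x) + (x ∸ z) * N      ≡⟨ cong (_+ (x ∸ z) * N) (trans (cong fromDigits (swapEnds-ends x mid z)) (fromDigits-ends z mid x)) ⟨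
  fromDigits (swapEnds (x ∷ mid ++ [ z ])) + (x ∸ z) * N ∎
  where
  open ≡-Reasoning
  L M N : ℕ
  L = length mid
  M = fromDigits mid
  N = nines (suc L)
  regroup : ∀ z a N M → (z + a) * suc N + (M + z) ≡ z * suc N + (M + (z + a)) + a * N
  regroup = solve-∀
  exchange : ∀ {x z} → z ≤ x → x * suc N + (10 * M + z) ≡ z * suc N + (10 * M + x) + (x ∸ z) * N
  exchange {x} {z} z≤x with x ∸ z | m+[n∸m]≡n z≤x
  ... | a | refl = regroup z a N (10 * M)

IsMaximum : ℕ → List ℕ → Set
IsMaximum x ds = x ∈ ds × All (_≤ x) ds

IsMinimum : ℕ → List ℕ → Set
IsMinimum z ds = z ∈ ds × All (z ≤_) ds

maximum-unique : ∀ {x y ds} → IsMaximum x ds → IsMaximum y ds → x ≡ y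
maximum-unique (x∈ , ≤x) (y∈ , ≤y) = ≤-antisym (All.lookup ≤y x∈) (All.lookup ≤x y∈)

minimum-unique : ∀ {x y ds} → IsMinimum x ds → IsMinimum y ds → x ≡ y
minimum-unique (x∈ , x≤) (y∈ , y≤) = ≤-antisym (All.lookup x≤ y∈) (All.lookup y≤ x∈)

descending-last≤ : ∀ x mid z → Linked _≥_ (x ∷ mid ++ [ z ]) → All (z ≤_) (x ∷ mid ++ [ z ])
descending-last≤ x []        z (z≤x ∷ _) = z≤x ∷ ≤-refl ∷ []
descending-last≤ x (y ∷ mid) z (y≤x ∷ L) with descending-last≤ y mid z L
... | z≤y ∷ z≤rest = ≤-trans z≤y y≤x ∷ z≤y ∷ z≤rest

∷ʳ-split : ∀ k (ys : List ℕ) → length ys ≡ suc k → ∃₂ λ mid z → ys ≡ mid ++ [ z ] × length mid ≡ k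
∷ʳ-split zero    (z ∷ [])     refl = [] , z , refl , refl
∷ʳ-split (suc k) (y ∷ ys)     eq   with ∷ʳ-split k ys (suc-injective eq)
... | mid , z , refl , refl = y ∷ mid , z , refl , refl

record SortedEnds (k : ℕ) (ds : List ℕ) : Set where
  field
    largest smallest : ℕ
    middle           : List ℕ
    sort≡            : sort ds ≡ largest ∷ middle ++ [ smallest ]
    length-middle    : length middle ≡ k
    isMaximum        : IsMaximum largest ds
    isMinimum        : IsMinimum smallest ds

sortedEnds : ∀ k ds → length ds ≡ suc (suc k) → SortedEnds k ds
sortedEnds k ds len with sort ds in sort-eq | sort-↭ ds | sort-↗ ds | ↭-length (sort-↭ ds)
... | [] | _ | _ | len′ with () ← trans len′ len
... | x ∷ ys | ↭ds | sorted | len′ with ∷ʳ-split k ys (suc-injective (trans len′ len))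
...   | mid , z , refl , len-mid = record
  { largest       = x
  ; smallest      = z
  ; middle        = mid
  ; sort≡         = sort-eq
  ; length-middle = len-mid
  ; isMaximum     = ∈-resp-↭ ↭ds (here refl) , All-resp-↭ ↭ds (Linked⇒All (flip ≤-trans) ≤-refl sorted)
  ; isMinimum     = ∈-resp-↭ ↭ds (there (∈-++⁺ʳ mid (here refl))) , All-resp-↭ ↭ds (descending-last≤ x mid z sorted)
  }

minimum<maximum : ∀ {x z ds} → IsMaximum x ds → IsMinimum z ds → ¬ All (_≡ x) ds → z < x
minimum<maximum (x∈ , ≤x) (_ , z≤) notConstant = ≤∧≢⇒< (All.lookup z≤ x∈) λ
  { refl → notConstant (All.tabulate λ d∈ → ≤-antisym (All.lookup ≤x d∈) (All.lookup z≤ d∈)) }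

T≡spread : ∀ k n {x z} → IsMaximum x (digits (suc (suc k)) n) → IsMinimum z (digits (suc (suc k)) n) →
           T (suc (suc k)) n ≡ + ((x ∸ z) * nines (suc k))
T≡spread k n {x} {z} x-max z-min = begin
  T w n                                                     ≡⟨ cong (λ s → + fromDigits s ℤ.- + fromDigits (swapEnds s)) sort≡ ⟩
  + fromDigits sorted ℤ.- + fromDigits (swapEnds sorted)    ≡⟨ m≡n+o⇒+m-+n≡+o _ (fromDigits-swapEnds middle smallest≤largest) ⟩
  + ((largest ∸ smallest) * nines (suc (length middle)))    ≡⟨ cong₂ (λ d L → + (d * nines (suc L))) spread≡ length-middle ⟩
  + ((x ∸ z) * nines (suc k))                               ∎
  where
  open ≡-Reasoning
  w : ℕ
  w = suc (suc k)
  open SortedEnds (sortedEnds k (digits w n) (length-digits w n))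
  sorted : List ℕ
  sorted = largest ∷ middle ++ [ smallest ]
  smallest≤largest : smallest ≤ largest
  smallest≤largest = All.lookup (proj₂ isMinimum) (proj₁ isMaximum)
  spread≡ : largest ∸ smallest ≡ x ∸ z
  spread≡ = cong₂ _∸_ (maximum-unique isMaximum x-max) (minimum-unique isMinimum z-min)

NonzeroDigit : ℕ → Set
NonzeroDigit a = 0 < a × a < 10

A⇒T≡ninesMultiple : ∀ k n → A (suc (suc k)) n → ∃ λ a → NonzeroDigit a × T (suc (suc k)) n ≡ + (a * nines (suc k))
A⇒T≡ninesMultiple k n (_ , _ , notAllEqual) =
  largest ∸ smallest , (spread>0 , spread<10) , T≡spread k n isMaximum isMinimum
  where
  w : ℕ
  w = suc (suc k)
  open SortedEnds (sortedEnds k (digits w n) (length-digits w n))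
  spread>0 : 0 < largest ∸ smallest
  spread>0 = m<n⇒0<n∸m (minimum<maximum isMaximum isMinimum λ all≡ → notAllEqual (largest , all≡))
  spread<10 : largest ∸ smallest < 10
  spread<10 = ≤-<-trans (m∸n≤m largest smallest) (All.lookup (digits-< w n) (proj₁ isMaximum))

ninesMultipleDigits : ℕ → ℕ → List ℕ
ninesMultipleDigits k a = pred a ∷ replicate k 9 ++ [ 10 ∸ a ]

length-ninesMultipleDigits : ∀ k a → length (ninesMultipleDigits k a) ≡ suc (suc k)
length-ninesMultipleDigits k a = cong suc (trans (length-∷ʳ (replicate k 9) (10 ∸ a)) (cong suc (length-replicate k)))

ninesMultipleDigits-< : ∀ k {a} → NonzeroDigit a → All (_< 10) (ninesMultipleDigits k a)
ninesMultipleDigits-< k {suc b} (_ , a<10) = <-trans (n<1+n b) a<10 ∷ ++⁺ (replicate⁺ k ≤-refl) (s≤s (m∸n≤m 9 b) ∷ [])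

fromDigits-ninesMultipleDigits : ∀ k {a} → NonzeroDigit a → fromDigits (ninesMultipleDigits k a) ≡ a * nines (suc k)
fromDigits-ninesMultipleDigits k {suc b} (_ , s≤s b<9) = begin
  fromDigits (b ∷ replicate k 9 ++ [ 9 ∸ b ])              ≡⟨ fromDigits-ends b (replicate k 9) (9 ∸ b) ⟩
  b * 10 ^ suc (length (replicate k 9)) + (10 * N + (9 ∸ b)) ≡⟨ cong (λ L → b * 10 ^ suc L + (10 * N + (9 ∸ b))) (length-replicate k) ⟩
  b * (10 * 10 ^ k) + (10 * N + (9 ∸ b))                   ≡⟨ cong (λ P → b * (10 * P) + (10 * N + (9 ∸ b))) (suc-nines k) ⟨
  b * (10 * suc N) + (10 * N + (9 ∸ b))                    ≡⟨ split-last-digit b (9 ∸ b) N ⟩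
  10 * b * N + 9 * b + 10 * N + (b + (9 ∸ b))              ≡⟨ cong (_+_ (10 * b * N + 9 * b + 10 * N)) (m+[n∸m]≡n (<⇒≤ b<9)) ⟩
  10 * b * N + 9 * b + 10 * N + 9                          ≡⟨ expand b N ⟨
  suc b * (10 * N + 9)                                     ≡⟨ cong (suc b *_) (nines-suc k) ⟨
  suc b * nines (suc k)                                    ∎
  where
  open ≡-Reasoning
  N : ℕ
  N = nines k
  split-last-digit : ∀ b c N → b * (10 * suc N) + (10 * N + c) ≡ 10 * b * N + 9 * b + 10 * N + (b + c)
  split-last-digit = solve-∀
  expand : ∀ b N → suc b * (10 * N + 9) ≡ 10 * b * N + 9 * b + 10 * N + 9
  expand = solve-∀

digits-ninesMultiple : ∀ k {a} → NonzeroDigit a → digits (suc (suc k)) (a * nines (suc k)) ≡ ninesMultipleDigits k a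
digits-ninesMultiple k {a} a-digit = subst (λ m → digits (suc (suc k)) m ≡ ninesMultipleDigits k a)
  (fromDigits-ninesMultipleDigits k a-digit)
  (digits-fromDigits (ninesMultipleDigits k a) (length-ninesMultipleDigits k a) (ninesMultipleDigits-< k a-digit))

ninesMultiple∈A : ∀ j {a} → NonzeroDigit a → A (suc (suc (suc j))) (a * nines (suc (suc j)))
ninesMultiple∈A j {a@(suc b)} a-digit@(_ , a<10) = positive , bounded , notAllEqual
  where
  k N : ℕ
  k = suc j
  N = nines (suc k)
  positive : 0 < a * N
  positive = <-≤-trans (nines-suc-pos k) (m≤m+n N (b * N))
  bounded : a * N ≤ 10 ^ suc (suc k) ∸ 1
  bounded = suc[m]≤n⇒m≤pred[n] (subst₂ (λ m L → m < 10 ^ L)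
    (fromDigits-ninesMultipleDigits k a-digit) (length-ninesMultipleDigits k a)
    (fromDigits-< (ninesMultipleDigits-< k a-digit)))
  notAllEqual : ¬ AllDigitsEqual (suc (suc k)) (a * N)
  notAllEqual (d , all≡) with subst (All (_≡ d)) (digits-ninesMultiple k a-digit) all≡
  ... | b≡d ∷ 9≡d ∷ _ = <⇒≢ (s≤s⁻¹ a<10) (trans b≡d (sym 9≡d))

nextSpread : ℕ → ℕ
nextSpread a = 9 ∸ (pred a ⊓ (10 ∸ a))

T-ninesMultiple : ∀ j {a} → NonzeroDigit a →
  T (suc (suc (suc j))) (a * nines (suc (suc j))) ≡ + (nextSpread a * nines (suc (suc j)))
T-ninesMultiple j {a} a-digit = T≡spread (suc j) (a * nines (suc (suc j)))
  (subst (IsMaximum 9) (sym digits≡) nine-max) (subst (IsMinimum m) (sym digits≡) m-min)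
  where
  digits≡ : digits (suc (suc (suc j))) (a * nines (suc (suc j))) ≡ ninesMultipleDigits (suc j) a
  digits≡ = digits-ninesMultiple (suc j) a-digit
  m : ℕ
  m = pred a ⊓ (10 ∸ a)
  nine-max : IsMaximum 9 (ninesMultipleDigits (suc j) a)
  nine-max = there (here refl) , All.map s≤s⁻¹ (ninesMultipleDigits-< (suc j) a-digit)
  m-min : IsMinimum m (ninesMultipleDigits (suc j) a)
  m-min = m∈ , m⊓n≤m _ _ ∷ ++⁺ (replicate⁺ (suc j) m≤9) (m⊓n≤n _ _ ∷ [])
    where
    m≤9 : m ≤ 9
    m≤9 = ≤-trans (m⊓n≤m _ _) (pred-mono-≤ (<⇒≤ (proj₂ a-digit)))
    m∈ : m ∈ ninesMultipleDigits (suc j) a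
    m∈ with ⊓-sel (pred a) (10 ∸ a)
    ... | inj₁ m≡ = here m≡
    ... | inj₂ m≡ = there (∈-++⁺ʳ (replicate (suc j) 9) (here m≡))

nextSpread-nonzeroDigit : ∀ {a} → a < 10 → NonzeroDigit (nextSpread a)
nextSpread-nonzeroDigit {a} a<10 =
  m<n⇒0<n∸m (s≤s (≤-trans (m⊓n≤m _ _) (pred-mono-≤ (s≤s⁻¹ a<10)))) , s≤s (m∸n≤m 9 (pred a ⊓ (10 ∸ a)))

nextSpread-fixedPoint : ∀ {a} → a < 10 → nextSpread a ≡ a → a ≡ 5
nextSpread-fixedPoint = toWitness {a? = allUpTo? (λ a → nextSpread a ≟ a →-dec a ≟ 5) 10} _

iter-nextSpread-6 : ∀ {a} → a < 10 → iter nextSpread 6 a ≡ 5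
iter-nextSpread-6 = toWitness {a? = allUpTo? (λ a → iter nextSpread 6 a ≟ 5) 10} _

iter-suc′ : ∀ f t x → iter f (suc t) x ≡ iter f t (f x)
iter-suc′ f zero    x = refl
iter-suc′ f (suc t) x = cong f (iter-suc′ f t x)

iter-preserves : ∀ {P : ℕ → Set} (g : ℕ → ℕ) → (∀ {a} → P a → P (g a)) → ∀ t {a} → P a → P (iter g t a)
iter-preserves g g-pres zero    Pa = Pa
iter-preserves {P} g g-pres (suc t) Pa = g-pres (iter-preserves {P = P} g g-pres t Pa)

iter-semiconj : ∀ {P : ℕ → Set} (f g h : ℕ → ℕ) → (∀ {a} → P a → P (g a)) →
  (∀ {a} → P a → f (h a) ≡ h (g a)) → ∀ t {a} → P a → iter f t (h a) ≡ h (iter g t a)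
iter-semiconj f g h g-pres f∘h≡h∘g zero    Pa = refl
iter-semiconj {P} f g h g-pres f∘h≡h∘g (suc t) Pa =
  trans (cong f (iter-semiconj f g h g-pres f∘h≡h∘g t Pa)) (f∘h≡h∘g (iter-preserves {P = P} g g-pres t Pa))

ninesMultiple-fixed⇒5 : ∀ j {a} → NonzeroDigit a →
  T (suc (suc (suc j))) (a * nines (suc (suc j))) ≡ + (a * nines (suc (suc j))) → a ≡ 5
ninesMultiple-fixed⇒5 j {a} a-digit fixed = nextSpread-fixedPoint (proj₂ a-digit)
  (*-cancelʳ-≡ (nextSpread a) a (nines (suc (suc j))) {{>-nonZero (nines-suc-pos (suc j))}}
    (ℤ.+-injective (trans (sym (T-ninesMultiple j a-digit)) fixed)))

five-nonzeroDigit : NonzeroDigit 5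
five-nonzeroDigit = z<s , s<s (s<s (s<s (s<s (s<s z<s))))

K≡5*nines : ∀ k → K (suc (suc k)) ≡ 5 * nines (suc k)
K≡5*nines k = fromDigits-ninesMultipleDigits k five-nonzeroDigit

A∩fixed⇒5*nines : ∀ j n → A (suc (suc (suc j))) n → T (suc (suc (suc j))) n ≡ + n → n ≡ 5 * nines (suc (suc j))
A∩fixed⇒5*nines j n n∈A fixed =
  let a , a-digit , Tn≡ = A⇒T≡ninesMultiple (suc j) n n∈A
      n≡aN : n ≡ a * N
      n≡aN = ℤ.+-injective (trans (sym fixed) Tn≡)
  in begin
  n      ≡⟨ n≡aN ⟩
  a * N  ≡⟨ cong (_* N) (ninesMultiple-fixed⇒5 j a-digit (subst (λ m → T w m ≡ + m) n≡aN fixed)) ⟩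
  5 * N  ∎
  where
  open ≡-Reasoning
  w N : ℕ
  w = suc (suc (suc j))
  N = nines (suc (suc j))

-- f stands for |T| but is kept abstract: with |T| itself, checking the chain below makes
-- the type checker unfold iter and evaluate T on open terms, which does not terminate in practice.
A⇒iter-7≡5*nines : ∀ j (f : ℕ → ℕ) → (∀ m → f m ≡ ∣ T (suc (suc (suc j))) m ∣) →
  ∀ n → A (suc (suc (suc j))) n → iter f 7 n ≡ 5 * nines (suc (suc j))
A⇒iter-7≡5*nines j f f≡∣T∣ n n∈A =
  let a , a-digit , Tn≡ = A⇒T≡ninesMultiple (suc j) n n∈A
  in begin
  iter f 7 n               ≡⟨ iter-suc′ f 6 n ⟩
  iter f 6 (f n)           ≡⟨ cong (iter f 6) (trans (f≡∣T∣ n) (cong ∣_∣ Tn≡)) ⟩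
  iter f 6 (a * N)         ≡⟨ iter-semiconj {P = NonzeroDigit} f nextSpread (_* N) (λ d → nextSpread-nonzeroDigit (proj₂ d)) f-step 6 a-digit ⟩
  iter nextSpread 6 a * N  ≡⟨ cong (_* N) (iter-nextSpread-6 (proj₂ a-digit)) ⟩
  5 * N                    ∎
  where
  open ≡-Reasoning
  N : ℕ
  N = nines (suc (suc j))
  f-step : ∀ {a} → NonzeroDigit a → f (a * N) ≡ nextSpread a * N
  f-step a-digit = trans (f≡∣T∣ _) (cong ∣_∣ (T-ninesMultiple j a-digit))

A⇒T∈A : ∀ j n → A (suc (suc (suc j))) n → Σ ℕ (λ m → (T (suc (suc (suc j))) n ≡ + m) × A (suc (suc (suc j))) m)
A⇒T∈A j n n∈A =
  let a , a-digit , Tn≡ = A⇒T≡ninesMultiple (suc j) n n∈A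
  in a * nines (suc (suc j)) , Tn≡ , ninesMultiple∈A j a-digit

mainTheorem5 : (w : ℕ) → 3 ≤ w →
    ((n : ℕ) → A w n → Σ ℕ (λ m → (T w n ≡ + m) × A w m))
    × (A w (K w) × (T w (K w) ≡ + K w) × ((n : ℕ) → A w n → T w n ≡ + n → n ≡ K w))
    × ((n : ℕ) → A w n → Σ ℕ (λ k → iter (λ m → ∣ T w m ∣) k n ≡ K w))
mainTheorem5 w@(suc (suc (suc j))) (s≤s (s≤s (s≤s z≤n))) =
  A⇒T∈A j ,
  ( subst (A w) K≡ (ninesMultiple∈A j five-nonzeroDigit)
  , subst (λ m → T w m ≡ + m) K≡ (T-ninesMultiple j five-nonzeroDigit)
  , λ n n∈A fixed → trans (A∩fixed⇒5*nines j n n∈A fixed) K≡ ) ,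
  λ n n∈A → 7 , trans (A⇒iter-7≡5*nines j (λ m → ∣ T w m ∣) (λ _ → refl) n n∈A) K≡
  where
  K≡ : 5 * nines (suc (suc j)) ≡ K w
  K≡ = sym (K≡5*nines (suc j))
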